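{- Let $\mathbf S=\langle S,\wedge,\vee,\cdot,1,\backslash,/\rangle$ be a residuated lattice, $\mathbf M$ a lattice, and suppose $\mathbf M$ is a residuated $\mathbf S$-bimodule with $1*x=x=x*1$ for all $x\in M$, pointed by an arbitrary $0\in M$. Then the restricted Nagata product $(\mathbf S\ltimes\mathbf M)_0=\{\langle a,x\rangle\in S\times M: 0*a\le x,\ a*0\le x\}$ is closed under the operations $\wedge,\vee,\circ,\backslash,/$ of $\mathbf S\ltimes\mathbf M$ given below, and is a residuated lattice with multiplicative unit $\langle 1,0\rangle$; in particular it is a residuated sub-$\ell$-semigroup of $\mathbf S\ltimes\mathbf M$.
   Context: Elements of $S$ are written $a,b$ and elements of $M$ written $x,y$. A residuated $\mathbf S$-bimodule: isotone actions $a*x\in M$, $x*a\in M$ with $(ab)*x=a*(b*x)$, $x*(ab)=(x*a)*b$, $(a*x)*b=a*(x*b)$, distributing over binary joins in $M$, and maps $\backslash_\ell:S\times M\to M$, $/_\ell:M\times M\to S$, $\backslash_r:M\times M\to S$, $/_r:M\times S\to M$ with $x\le a\backslash_\ell y\iff a*x\le y\iff a\le y/_\ell x$ and $x\le y/_r a\iff x*a\le y\iff a\le x\backslash_r y$. The Nagata product $\mathbf S\ltimes\mathbf M$ has universe $S\times M$ with $\langle a,x\rangle\wedge\langle b,y\rangle=\langle a\wedge b,x\wedge y\rangle$, $\langle a,x\rangle\vee\langle b,y\rangle=\langle a\vee b,x\vee y\rangle$, $\langle a,x\rangle\circ\langle b,y\rangle=\langle a\cdot b,x*b\vee a*y\rangle$,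 $\langle a,x\rangle\backslash\langle b,y\rangle=\langle a\backslash b\wedge x\backslash_r y,a\backslash_\ell y\rangle$, $\langle a,x\rangle/\langle b,y\rangle=\langle a/b\wedge x/_\ell y,x/_r b\rangle$; it is a residuated $\ell$-semigroup (lattice with residuated multiplication). -}

module Defs where

open import Level using (0ℓ)
open import Data.Product using (Σ; _×_; _,_; proj₁; proj₂)
open import Relation.Binary.Core using (Rel)
open import Algebra.Core using (Op₂)
open import Algebra.Structures using (IsMonoid)
open import Algebra.Lattice.Structures using (IsLattice)
open import Algebra.Lattice.Bundles using (Lattice)

record IsResiduatedLattice {A : Set} (_≈_ : Rel A 0ℓ)
         (_∧_ _∨_ _·_ : Op₂ A) (e : A) (_⧵_ _//_ : Op₂ A) : Set where
  field
    isLattice : IsLattice _≈_ _∨_ _∧_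
    isMonoid  : IsMonoid _≈_ _·_ e
  _≤_ : Rel A 0ℓ
  x ≤ y = (x ∧ y) ≈ x
  field
    resˡ-to   : ∀ {x y z} → y ≤ (x ⧵ z) → (x · y) ≤ z
    resˡ-from : ∀ {x y z} → (x · y) ≤ z → y ≤ (x ⧵ z)
    resʳ-to   : ∀ {x y z} → x ≤ (z // y) → (x · y) ≤ z
    resʳ-from : ∀ {x y z} → (x · y) ≤ z → x ≤ (z // y)

record ResiduatedLattice : Set₁ where
  infixl 7 _·_
  field
    Carrier : Set
    _≈_     : Rel Carrier 0ℓ
    _∧_ _∨_ _·_ : Op₂ Carrier
    one     : Carrier
    _⧵_ _//_ : Op₂ Carrier
    isResiduatedLattice : IsResiduatedLattice _≈_ _∧_ _∨_ _·_ one _⧵_ _//_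
  open IsResiduatedLattice isResiduatedLattice public

module _ (S : ResiduatedLattice) (M : Lattice 0ℓ 0ℓ) where
  private
    module S = ResiduatedLattice S
    module M = Lattice M

  _≤M_ : Rel M.Carrier 0ℓ
  x ≤M y = (x M.∧ y) M.≈ x

  record ResiduatedBimodule : Set where
    field
      _*ₗ_ : S.Carrier → M.Carrier → M.Carrier
      _*ᵣ_ : M.Carrier → S.Carrier → M.Carrier
      *ₗ-mono : ∀ {a b x y} → a S.≤ b → x ≤M y → (a *ₗ x) ≤M (b *ₗ y)
      *ᵣ-mono : ∀ {a b x y} → x ≤M y → a S.≤ b → (x *ᵣ a) ≤M (y *ᵣ b)
      *ₗ-assoc : ∀ a b x → ((a S.· b) *ₗ x) M.≈ (a *ₗ (b *ₗ x))
      *ᵣ-assoc : ∀ x a b → (x *ᵣ (a S.· b)) M.≈ ((x *ᵣ a) *ᵣ b)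
      *-middle : ∀ a x b → ((a *ₗ x) *ᵣ b) M.≈ (a *ₗ (x *ᵣ b))
      *ₗ-distrib-∨ : ∀ a x y → (a *ₗ (x M.∨ y)) M.≈ ((a *ₗ x) M.∨ (a *ₗ y))
      *ᵣ-distrib-∨ : ∀ x y a → ((x M.∨ y) *ᵣ a) M.≈ ((x *ᵣ a) M.∨ (y *ᵣ a))
      _⧵ₗ_ : S.Carrier → M.Carrier → M.Carrier
      _/ₗ_ : M.Carrier → M.Carrier → S.Carrier
      _⧵ᵣ_ : M.Carrier → M.Carrier → S.Carrier
      _/ᵣ_ : M.Carrier → S.Carrier → M.Carrier
      ⧵ₗ-to   : ∀ {a x y} → x ≤M (a ⧵ₗ y) → (a *ₗ x) ≤M y
      ⧵ₗ-from : ∀ {a x y} → (a *ₗ x) ≤M y → x ≤M (a ⧵ₗ y)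
      /ₗ-to   : ∀ {a x y} → a S.≤ (y /ₗ x) → (a *ₗ x) ≤M y
      /ₗ-from : ∀ {a x y} → (a *ₗ x) ≤M y → a S.≤ (y /ₗ x)
      /ᵣ-to   : ∀ {a x y} → x ≤M (y /ᵣ a) → (x *ᵣ a) ≤M y
      /ᵣ-from : ∀ {a x y} → (x *ᵣ a) ≤M y → x ≤M (y /ᵣ a)
      ⧵ᵣ-to   : ∀ {a x y} → a S.≤ (x ⧵ᵣ y) → (x *ᵣ a) ≤M y
      ⧵ᵣ-from : ∀ {a x y} → (x *ᵣ a) ≤M y → a S.≤ (x ⧵ᵣ y)

  Unital : ResiduatedBimodule → Set
  Unital B = ∀ x → ((S.one *ₗ x) M.≈ x) × ((x *ᵣ S.one) M.≈ x)
    where open ResiduatedBimodule B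

  module Nagata (B : ResiduatedBimodule) where
    open ResiduatedBimodule B

    P : Set
    P = S.Carrier × M.Carrier

    _≈N_ : Rel P 0ℓ
    (a , x) ≈N (b , y) = (a S.≈ b) × (x M.≈ y)

    _∧N_ : Op₂ P
    (a , x) ∧N (b , y) = (a S.∧ b , x M.∧ y)

    _∨N_ : Op₂ P
    (a , x) ∨N (b , y) = (a S.∨ b , x M.∨ y)

    _∘N_ : Op₂ P
    (a , x) ∘N (b , y) = (a S.· b , (x *ᵣ b) M.∨ (a *ₗ y))

    _⧵N_ : Op₂ P
    (a , x) ⧵N (b , y) = ((a S.⧵ b) S.∧ (x ⧵ᵣ y) , a ⧵ₗ y)

    _/N_ : Op₂ P
    (a , x) /N (b , y) = ((a S.// b) S.∧ (x /ₗ y) , x /ᵣ b)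

    In₀ : M.Carrier → P → Set
    In₀ z (a , x) = ((z *ᵣ a) ≤M x) × ((a *ₗ z) ≤M x)

    Sub₀ : M.Carrier → Set
    Sub₀ z = Σ P (In₀ z)

    Closed₂ : M.Carrier → Op₂ P → Set
    Closed₂ z _op_ = ∀ p q → In₀ z p → In₀ z q → In₀ z (p op q)

    record Closure (z : M.Carrier) : Set where
      field
        ∧-closed : Closed₂ z _∧N_
        ∨-closed : Closed₂ z _∨N_
        ∘-closed : Closed₂ z _∘N_
        ⧵-closed : Closed₂ z _⧵N_
        /-closed : Closed₂ z _/N_

    module Restricted (z : M.Carrier) (C : Closure z) where
      open Closure C

      _≈₀_ : Rel (Sub₀ z) 0ℓ
      p ≈₀ q = proj₁ p ≈N proj₁ q

      lift : (_op_ : Op₂ P) → Closed₂ z _op_ → Op₂ (Sub₀ z)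
      lift _op_ cl (p , hp) (q , hq) = (p op q , cl p q hp hq)

      IsRL₀ : (unit : Sub₀ z) → Set
      IsRL₀ unit = IsResiduatedLattice _≈₀_
        (lift _∧N_ ∧-closed) (lift _∨N_ ∨-closed) (lift _∘N_ ∘-closed) unit
        (lift _⧵N_ ⧵-closed) (lift _/N_ /-closed)

{-# OPTIONS --safe #-}
module Submission where

-- Closure under ∧ and ∘
-- follows from monotonicity and associativity of the actions, closure under ∨ from the
-- fact that actions with residuals preserve joins, and closure under ⧵ and / by moving the
-- action across a residual, e.g. a *ₗ (z *ᵣ c) ≈ (a *ₗ z) *ᵣ c ≤ x *ᵣ (x ⧵ᵣ y) ≤ y for
-- c = (a ⧵ b) ∧ (x ⧵ᵣ y).  The same two inequalities make ⟨1 , z⟩ a two-sided unit on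
-- (S ⋉ M)₀, since ⟨1 , z⟩ ∘ ⟨a , x⟩ = ⟨a , z *ᵣ a ∨ x⟩.  The lattice laws, associativity
-- and residuation already hold in S ⋉ M and pull back along the embedding proj₁.

open import Defs
open import Level using (0ℓ)
open import Data.Product using (Σ; _,_; proj₁; proj₂)
open import Function using (id)
open import Relation.Binary.Core using (Rel)
import Relation.Binary.Lattice
import Algebra.Lattice.Properties.Lattice as LatticeProperties
import Relation.Binary.Lattice.Properties.JoinSemilattice
import Relation.Binary.Reasoning.Setoid
open import Algebra.Bundles using (RawMagma)
open import Algebra.Structures using (IsSemigroup; IsMonoid)
open import Algebra.Lattice.Bundles using (Lattice; RawLattice)
open import Algebra.Lattice.Structures using (IsLattice)
open import Algebra.Morphism.Structures using (IsMagmaMonomorphism)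
open import Algebra.Lattice.Morphism.Structures using (module LatticeMorphisms)
open LatticeMorphisms using (IsLatticeMonomorphism)
import Algebra.Morphism.MagmaMonomorphism as MagmaMonomorphism
import Algebra.Lattice.Morphism.LatticeMonomorphism as LatticeMonomorphism

module LatticeOrder {a ℓ} {A : Set a} {_≈_ : Rel A ℓ} {_∨_ _∧_ : A → A → A}
                    (isLattice : IsLattice _≈_ _∨_ _∧_) where

  open IsLattice isLattice using (sym)

  private
    lattice : Lattice a ℓ
    lattice = record { isLattice = isLattice }

    module O = Relation.Binary.Lattice.Lattice (LatticeProperties.∨-∧-orderTheoreticLattice lattice)
    module O-Join = Relation.Binary.Lattice.Properties.JoinSemilattice O.joinSemilattice

  -- Agrees with ResiduatedLattice._≤_; the library's natural order O._≤_ is the mirrored x ≈ x ∧ y.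
  _≤_ : Rel A ℓ
  x ≤ y = (x ∧ y) ≈ x

  ≤-refl : ∀ {x} → x ≤ x
  ≤-refl = sym O.refl

  ≤-reflexive : ∀ {x y} → x ≈ y → x ≤ y
  ≤-reflexive x≈y = sym (O.reflexive x≈y)

  ≤-trans : ∀ {x y w} → x ≤ y → y ≤ w → x ≤ w
  ≤-trans x≤y y≤w = sym (O.trans (sym x≤y) (sym y≤w))

  ≤-antisym : ∀ {x y} → x ≤ y → y ≤ x → x ≈ y
  ≤-antisym x≤y y≤x = O.antisym (sym x≤y) (sym y≤x)

  x∧y≤x : ∀ {x y} → (x ∧ y) ≤ x
  x∧y≤x = sym (O.x∧y≤x _ _)

  x∧y≤y : ∀ {x y} → (x ∧ y) ≤ y
  x∧y≤y = sym (O.x∧y≤y _ _)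

  ∧-greatest : ∀ {x y w} → x ≤ y → x ≤ w → x ≤ (y ∧ w)
  ∧-greatest x≤y x≤w = sym (O.∧-greatest (sym x≤y) (sym x≤w))

  x≤x∨y : ∀ {x y} → x ≤ (x ∨ y)
  x≤x∨y = sym (O.x≤x∨y _ _)

  y≤x∨y : ∀ {x y} → y ≤ (x ∨ y)
  y≤x∨y = sym (O.y≤x∨y _ _)

  ∨-least : ∀ {x y w} → x ≤ w → y ≤ w → (x ∨ y) ≤ w
  ∨-least x≤w y≤w = sym (O.∨-least (sym x≤w) (sym y≤w))

  x≤y⇒x∨y≈y : ∀ {x y} → x ≤ y → (x ∨ y) ≈ y
  x≤y⇒x∨y≈y x≤y = O-Join.x≤y⇒x∨y≈y (sym x≤y)

module NagataProduct (S : ResiduatedLattice) (M : Lattice 0ℓ 0ℓ)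
                     (B : ResiduatedBimodule S M) where

  private
    module S = ResiduatedLattice S
    module SL = IsLattice S.isLattice
    module M = Lattice M
    module S≤ = LatticeOrder S.isLattice
    module M≤ = LatticeOrder M.isLattice
    module S· = IsMonoid S.isMonoid

  open ResiduatedBimodule B
  open Nagata S M B

  *ₗ-cong : ∀ {a b x y} → a S.≈ b → x M.≈ y → (a *ₗ x) M.≈ (b *ₗ y)
  *ₗ-cong a≈b x≈y = M≤.≤-antisym
    (*ₗ-mono (S≤.≤-reflexive a≈b) (M≤.≤-reflexive x≈y))
    (*ₗ-mono (S≤.≤-reflexive (SL.sym a≈b)) (M≤.≤-reflexive (M.sym x≈y)))

  *ᵣ-cong : ∀ {a b x y} → x M.≈ y → a S.≈ b → (x *ᵣ a) M.≈ (y *ᵣ b)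
  *ᵣ-cong x≈y a≈b = M≤.≤-antisym
    (*ᵣ-mono (M≤.≤-reflexive x≈y) (S≤.≤-reflexive a≈b))
    (*ᵣ-mono (M≤.≤-reflexive (M.sym x≈y)) (S≤.≤-reflexive (SL.sym a≈b)))

  *ₗ-monoˡ : ∀ {a b x} → a S.≤ b → (a *ₗ x) M≤.≤ (b *ₗ x)
  *ₗ-monoˡ a≤b = *ₗ-mono a≤b M≤.≤-refl

  *ₗ-monoʳ : ∀ {a x y} → x M≤.≤ y → (a *ₗ x) M≤.≤ (a *ₗ y)
  *ₗ-monoʳ x≤y = *ₗ-mono S≤.≤-refl x≤y

  *ᵣ-monoˡ : ∀ {a x y} → x M≤.≤ y → (x *ᵣ a) M≤.≤ (y *ᵣ a)
  *ᵣ-monoˡ x≤y = *ᵣ-mono x≤y S≤.≤-refl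

  *ᵣ-monoʳ : ∀ {a b x} → a S.≤ b → (x *ᵣ a) M≤.≤ (x *ᵣ b)
  *ᵣ-monoʳ a≤b = *ᵣ-mono M≤.≤-refl a≤b

  -- The axioms give distributivity over joins of M only; joins of S are preserved because
  -- x *ᵣ_ and _*ₗ x have the upper adjoints x ⧵ᵣ_ and _/ₗ x.
  *ᵣ-∨-least : ∀ {x a b w} → (x *ᵣ a) M≤.≤ w → (x *ᵣ b) M≤.≤ w → (x *ᵣ (a S.∨ b)) M≤.≤ w
  *ᵣ-∨-least xa≤w xb≤w = ⧵ᵣ-to (S≤.∨-least (⧵ᵣ-from xa≤w) (⧵ᵣ-from xb≤w))

  *ₗ-∨-least : ∀ {x a b w} → (a *ₗ x) M≤.≤ w → (b *ₗ x) M≤.≤ w → ((a S.∨ b) *ₗ x) M≤.≤ w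
  *ₗ-∨-least ax≤w bx≤w = /ₗ-to (S≤.∨-least (/ₗ-from ax≤w) (/ₗ-from bx≤w))

  _≤N_ : Rel P 0ℓ
  p ≤N q = (p ∧N q) ≈N p

  isLattice : IsLattice _≈N_ _∨N_ _∧N_
  isLattice = record
    { isEquivalence = record
      { refl  = SL.refl , M.refl
      ; sym   = λ (a≈b , x≈y) → SL.sym a≈b , M.sym x≈y
      ; trans = λ (a≈b , x≈y) (b≈c , y≈w) → SL.trans a≈b b≈c , M.trans x≈y y≈w
      }
    ; ∨-comm     = λ p q → SL.∨-comm _ _ , M.∨-comm _ _
    ; ∨-assoc    = λ p q r → SL.∨-assoc _ _ _ , M.∨-assoc _ _ _
    ; ∨-cong     = λ (a≈b , x≈y) (c≈d , w≈v) → SL.∨-cong a≈b c≈d , M.∨-cong x≈y w≈v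
    ; ∧-comm     = λ p q → SL.∧-comm _ _ , M.∧-comm _ _
    ; ∧-assoc    = λ p q r → SL.∧-assoc _ _ _ , M.∧-assoc _ _ _
    ; ∧-cong     = λ (a≈b , x≈y) (c≈d , w≈v) → SL.∧-cong a≈b c≈d , M.∧-cong x≈y w≈v
    ; absorptive = (λ p q → SL.∨-absorbs-∧ _ _ , M.∨-absorbs-∧ _ _)
                 , (λ p q → SL.∧-absorbs-∨ _ _ , M.∧-absorbs-∨ _ _)
    }

  ∘N-cong : ∀ {p p′ q q′} → p ≈N p′ → q ≈N q′ → (p ∘N q) ≈N (p′ ∘N q′)
  ∘N-cong (a≈a′ , x≈x′) (b≈b′ , y≈y′) =
    S·.∙-cong a≈a′ b≈b′ , M.∨-cong (*ᵣ-cong x≈x′ b≈b′) (*ₗ-cong a≈a′ y≈y′)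

  ∘N-assoc : ∀ p q r → ((p ∘N q) ∘N r) ≈N (p ∘N (q ∘N r))
  ∘N-assoc (a , x) (b , y) (c , w) = S·.assoc a b c , (begin
    ((x *ᵣ b) M.∨ (a *ₗ y)) *ᵣ c M.∨ (a S.· b) *ₗ w
      ≈⟨ M.∨-cong (*ᵣ-distrib-∨ (x *ᵣ b) (a *ₗ y) c) (*ₗ-assoc a b w) ⟩
    ((x *ᵣ b) *ᵣ c M.∨ (a *ₗ y) *ᵣ c) M.∨ a *ₗ (b *ₗ w)
      ≈⟨ M.∨-assoc _ _ _ ⟩
    (x *ᵣ b) *ᵣ c M.∨ ((a *ₗ y) *ᵣ c M.∨ a *ₗ (b *ₗ w))
      ≈⟨ M.∨-cong (M.sym (*ᵣ-assoc x b c)) (M.∨-cong (*-middle a y c) M.refl) ⟩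
    x *ᵣ (b S.· c) M.∨ (a *ₗ (y *ᵣ c) M.∨ a *ₗ (b *ₗ w))
      ≈⟨ M.∨-cong M.refl (M.sym (*ₗ-distrib-∨ a (y *ᵣ c) (b *ₗ w))) ⟩
    x *ᵣ (b S.· c) M.∨ a *ₗ (y *ᵣ c M.∨ b *ₗ w) ∎)
    where open Relation.Binary.Reasoning.Setoid M.setoid

  isSemigroup : IsSemigroup _≈N_ _∘N_
  isSemigroup = record
    { isMagma = record
      { isEquivalence = IsLattice.isEquivalence isLattice
      ; ∙-cong        = ∘N-cong
      }
    ; assoc = ∘N-assoc
    }

  ∘N-resˡ-to : ∀ {p q r} → q ≤N (p ⧵N r) → (p ∘N q) ≤N r
  ∘N-resˡ-to (b≤ , y≤) =
    S.resˡ-to (S≤.≤-trans b≤ S≤.x∧y≤x) , M≤.∨-least (⧵ᵣ-to (S≤.≤-trans b≤ S≤.x∧y≤y)) (⧵ₗ-to y≤)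

  ∘N-resˡ-from : ∀ {p q r} → (p ∘N q) ≤N r → q ≤N (p ⧵N r)
  ∘N-resˡ-from (ab≤c , xb∨ay≤w) =
    S≤.∧-greatest (S.resˡ-from ab≤c) (⧵ᵣ-from (M≤.≤-trans M≤.x≤x∨y xb∨ay≤w)) ,
    ⧵ₗ-from (M≤.≤-trans M≤.y≤x∨y xb∨ay≤w)

  ∘N-resʳ-to : ∀ {p q r} → p ≤N (r /N q) → (p ∘N q) ≤N r
  ∘N-resʳ-to (a≤ , x≤) =
    S.resʳ-to (S≤.≤-trans a≤ S≤.x∧y≤x) , M≤.∨-least (/ᵣ-to x≤) (/ₗ-to (S≤.≤-trans a≤ S≤.x∧y≤y))

  ∘N-resʳ-from : ∀ {p q r} → (p ∘N q) ≤N r → p ≤N (r /N q)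
  ∘N-resʳ-from (ab≤c , xb∨ay≤w) =
    S≤.∧-greatest (S.resʳ-from ab≤c) (/ₗ-from (M≤.≤-trans M≤.y≤x∨y xb∨ay≤w)) ,
    /ᵣ-from (M≤.≤-trans M≤.x≤x∨y xb∨ay≤w)

  module _ (z : M.Carrier) where

    ∧N-closed : Closed₂ z _∧N_
    ∧N-closed _ _ (za≤x , az≤x) (zb≤y , bz≤y) =
      M≤.∧-greatest (M≤.≤-trans (*ᵣ-monoʳ S≤.x∧y≤x) za≤x) (M≤.≤-trans (*ᵣ-monoʳ S≤.x∧y≤y) zb≤y) ,
      M≤.∧-greatest (M≤.≤-trans (*ₗ-monoˡ S≤.x∧y≤x) az≤x) (M≤.≤-trans (*ₗ-monoˡ S≤.x∧y≤y) bz≤y)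

    ∨N-closed : Closed₂ z _∨N_
    ∨N-closed _ _ (za≤x , az≤x) (zb≤y , bz≤y) =
      *ᵣ-∨-least (M≤.≤-trans za≤x M≤.x≤x∨y) (M≤.≤-trans zb≤y M≤.y≤x∨y) ,
      *ₗ-∨-least (M≤.≤-trans az≤x M≤.x≤x∨y) (M≤.≤-trans bz≤y M≤.y≤x∨y)

    ∘N-closed : Closed₂ z _∘N_
    ∘N-closed (a , _) (b , _) (za≤x , _) (_ , bz≤y) =
      M≤.≤-trans (M≤.≤-reflexive (*ᵣ-assoc z a b)) (M≤.≤-trans (*ᵣ-monoˡ za≤x) M≤.x≤x∨y) ,
      M≤.≤-trans (M≤.≤-reflexive (*ₗ-assoc a b z)) (M≤.≤-trans (*ₗ-monoʳ bz≤y) M≤.y≤x∨y)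

    ⧵N-closed : Closed₂ z _⧵N_
    ⧵N-closed (a , _) _ (_ , az≤x) (_ , bz≤y) =
      ⧵ₗ-from (M≤.≤-trans (M≤.≤-reflexive (M.sym (*-middle a z _)))
        (M≤.≤-trans (*ᵣ-monoˡ az≤x) (M≤.≤-trans (*ᵣ-monoʳ S≤.x∧y≤y) (⧵ᵣ-to S≤.≤-refl)))) ,
      ⧵ₗ-from (M≤.≤-trans (M≤.≤-reflexive (M.sym (*ₗ-assoc a _ z)))
        (M≤.≤-trans (*ₗ-monoˡ (S.resˡ-to S≤.x∧y≤x)) bz≤y))

    /N-closed : Closed₂ z _/N_
    /N-closed _ (b , _) (za≤x , _) (zb≤y , _) =
      /ᵣ-from (M≤.≤-trans (M≤.≤-reflexive (M.sym (*ᵣ-assoc z _ b)))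
        (M≤.≤-trans (*ᵣ-monoʳ (S.resʳ-to S≤.x∧y≤x)) za≤x)) ,
      /ᵣ-from (M≤.≤-trans (M≤.≤-reflexive (*-middle _ z b))
        (M≤.≤-trans (*ₗ-monoʳ zb≤y) (M≤.≤-trans (*ₗ-monoˡ S≤.x∧y≤y) (/ₗ-to S≤.≤-refl))))

    closure : Closure z
    closure = record
      { ∧-closed = ∧N-closed
      ; ∨-closed = ∨N-closed
      ; ∘-closed = ∘N-closed
      ; ⧵-closed = ⧵N-closed
      ; /-closed = /N-closed
      }

  module _ (unital : Unital S M B) (z : M.Carrier) where

    one-In₀ : In₀ z (S.one , z)
    one-In₀ = M≤.≤-reflexive (proj₂ (unital z)) , M≤.≤-reflexive (proj₁ (unital z))

    ∘N-identityˡ : ∀ {p} → In₀ z p → ((S.one , z) ∘N p) ≈N p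
    ∘N-identityˡ {a , x} (za≤x , _) = S·.identityˡ a ,
      M.trans (M.∨-cong M.refl (proj₁ (unital x))) (M≤.x≤y⇒x∨y≈y za≤x)

    ∘N-identityʳ : ∀ {p} → In₀ z p → (p ∘N (S.one , z)) ≈N p
    ∘N-identityʳ {a , x} (_ , az≤x) = S·.identityʳ a ,
      M.trans (M.∨-cong (proj₂ (unital x)) M.refl) (M.trans (M.∨-comm _ _) (M≤.x≤y⇒x∨y≈y az≤x))

  module _ (z : M.Carrier) (C : Closure z) where
    open Restricted z C
    open Closure C

    private
      rawLatticeN : RawLattice 0ℓ 0ℓ
      rawLatticeN = record { _≈_ = _≈N_ ; _∧_ = _∧N_ ; _∨_ = _∨N_ }

      rawLattice₀ : RawLattice 0ℓ 0ℓ
      rawLattice₀ = record { _≈_ = _≈₀_ ; _∧_ = lift _∧N_ ∧-closed ; _∨_ = lift _∨N_ ∨-closed }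

      rawMagmaN : RawMagma 0ℓ 0ℓ
      rawMagmaN = record { _≈_ = _≈N_ ; _∙_ = _∘N_ }

      rawMagma₀ : RawMagma 0ℓ 0ℓ
      rawMagma₀ = record { _≈_ = _≈₀_ ; _∙_ = lift _∘N_ ∘-closed }

      open IsLattice isLattice using (refl)

    proj₁-isLatticeMonomorphism : IsLatticeMonomorphism rawLattice₀ rawLatticeN proj₁
    proj₁-isLatticeMonomorphism = record
      { isLatticeHomomorphism = record
        { isRelHomomorphism = record { cong = id }
        ; ∧-homo = λ _ _ → refl
        ; ∨-homo = λ _ _ → refl
        }
      ; injective = id
      }

    proj₁-isMagmaMonomorphism : IsMagmaMonomorphism rawMagma₀ rawMagmaN proj₁
    proj₁-isMagmaMonomorphism = record
      { isMagmaHomomorphism = record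
        { isRelHomomorphism = record { cong = id }
        ; homo = λ _ _ → refl
        }
      ; injective = id
      }

    isResiduatedLattice₀ : (unital : Unital S M B) (one∈ : In₀ z (S.one , z)) →
                           IsRL₀ ((S.one , z) , one∈)
    isResiduatedLattice₀ unital one∈ = record
      { isLattice = LatticeMonomorphism.isLattice proj₁-isLatticeMonomorphism isLattice
      ; isMonoid  = record
        { isSemigroup = MagmaMonomorphism.isSemigroup proj₁-isMagmaMonomorphism isSemigroup
        ; identity    = (λ (_ , p∈) → ∘N-identityˡ unital z p∈)
                      , (λ (_ , p∈) → ∘N-identityʳ unital z p∈)
        }
      ; resˡ-to   = ∘N-resˡ-to
      ; resˡ-from = ∘N-resˡ-from
      ; resʳ-to   = ∘N-resʳ-to
      ; resʳ-from = ∘N-resʳ-from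
      }

mainTheorem6 : (S : ResiduatedLattice) (M : Lattice 0ℓ 0ℓ)
    (B : ResiduatedBimodule S M) → Unital S M B →
    (z : Lattice.Carrier M) →
    Σ (Nagata.Closure S M B z) λ C →
      Σ (Nagata.In₀ S M B z (ResiduatedLattice.one S , z)) λ u →
        Nagata.Restricted.IsRL₀ S M B z C ((ResiduatedLattice.one S , z) , u)
mainTheorem6 S M B unital z =
  closure z , one-In₀ unital z , isResiduatedLattice₀ z (closure z) unital (one-In₀ unital z)
  where open NagataProduct S M B
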